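{- Let $L,L'$ be complete lattices, $S\subseteq\mathrm{FinAdd}_L$ a $^*$-continuous Kleene algebra, and $V\subseteq\mathrm{FinAdd}_{L,L'}$ an $S$-semimodule. Then $(S,V)$ is a generalized $^*$-continuous Kleene algebra if and only if $f^*v=\bigvee_{n\ge0}f^nv$ for all $f\in S$ and $v\in V$.
   Context: Functions are written on the right and composed left to right: $xf$ is $f$ applied to $x$, $fg$ (or $f;g$) means "first $f$, then $g$". For complete lattices $L,L'$, $f:L\to L'$ is finitely additive if $\bot f=\bot$ and $(x\vee y)f=xf\vee yf$; $\mathrm{FinAdd}_{L,L'}$ is the set of such maps, ordered pointwise with pointwise suprema; $\bot$ also denotes the constant $\bot$ map; $\mathrm{FinAdd}_L=\mathrm{FinAdd}_{L,L}$. For $f\in\mathrm{FinAdd}_L$: $f^0=\mathrm{id}$, $f^{n+1}=f^nf$, $f^*=\bigvee_nf^n$. $S\subseteq\mathrm{FinAdd}_L$ is a $^*$-continuous Kleene algebra if it contains $\bot,\mathrm{id}$, is closed under $\vee$, composition and $^*$, is a Kleene algebra (for $x,y\in S$, $yx^*$ is the least $z\in S$ with $z=zx\vee y$ and $x^*y$ the least $z\in S$ with $z=xz\vee y$), and $y(\bigvee_nx^n)=\bigvee_nyx^n$, $(\bigvee_nx^n)y=\bigvee_nx^ny$ for all $x,y\in S$. $V$ is an $S$-semimodule if $\bot\in V$ and $V$ is closed under $\vee$ and under the action $fv=f;v$ ($f\in S$, $v\in V$). $(S,V)$ is a generalized $^*$-continuous Kleene algebra if $xy^*v=\bigvee_{n\ge0}xy^nv$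 for all $x,y\in S$, $v\in V$ (pointwise supremum). -}

module Defs where

open import Level using (Level; suc; _⊔_; Lift; lift; lower)
open import Data.Nat using (ℕ; zero) renaming (suc to 1+)
open import Data.Bool using (Bool; true; false; if_then_else_)
open import Data.Empty.Polymorphic using (⊥)
open import Relation.Binary.PropositionalEquality using (_≡_)
open import Relation.Binary.Structures using (IsPartialOrder)

record CompleteLattice (c ℓ : Level) : Set (suc (c ⊔ ℓ)) where
  infix 4 _≤_
  field
    Carrier        : Set c
    _≤_            : Carrier → Carrier → Set ℓ
    isPartialOrder : IsPartialOrder _≡_ _≤_
    ⋁              : {I : Set c} → (I → Carrier) → Carrier
    ⋁-upper        : {I : Set c} (f : I → Carrier) (i : I) → f i ≤ ⋁ f
    ⋁-least        : {I : Set c} (f : I → Carrier) (x : Carrier) →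
                     ((i : I) → f i ≤ x) → ⋁ f ≤ x

  ⊥L : Carrier
  ⊥L = ⋁ {⊥} (λ ())

  infixr 6 _∨_
  _∨_ : Carrier → Carrier → Carrier
  x ∨ y = ⋁ {Lift c Bool} (λ b → if lower b then x else y)

  ⋁ℕ : (ℕ → Carrier) → Carrier
  ⋁ℕ f = ⋁ {Lift c ℕ} (λ n → f (lower n))

open CompleteLattice

-- Maps are written on the right: x f.  We represent a map L → L' as an Agda
-- function, and "f ; g" (first f, then g) as  fg x = g (f x).
Map : ∀ {c ℓ c' ℓ'} → CompleteLattice c ℓ → CompleteLattice c' ℓ' → Set (c ⊔ c')
Map L L' = Carrier L → Carrier L'

infixl 7 _⨾_
_⨾_ : ∀ {a b d} {A : Set a} {B : Set b} {D : Set d} → (A → B) → (B → D) → (A → D)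
(f ⨾ g) x = g (f x)

record FinAdd {c ℓ c' ℓ'} (L : CompleteLattice c ℓ) (L' : CompleteLattice c' ℓ')
              (f : Map L L') : Set (c ⊔ c') where
  field
    pres-⊥ : f (⊥L L) ≡ ⊥L L'
    pres-∨ : ∀ x y → f (_∨_ L x y) ≡ _∨_ L' (f x) (f y)

module MapOps {c ℓ c' ℓ'} (L : CompleteLattice c ℓ) (L' : CompleteLattice c' ℓ') where
  infix 4 _≐_ _⊑_
  infixr 6 _∨M_
  _≐_ : Map L L' → Map L L' → Set (c ⊔ c')
  f ≐ g = ∀ x → f x ≡ g x

  _⊑_ : Map L L' → Map L L' → Set (c ⊔ ℓ')
  f ⊑ g = ∀ x → _≤_ L' (f x) (g x)

  ⊥M : Map L L'
  ⊥M _ = ⊥L L'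

  _∨M_ : Map L L' → Map L L' → Map L L'
  (f ∨M g) x = _∨_ L' (f x) (g x)

  ⋁M : (ℕ → Map L L') → Map L L'
  ⋁M fs x = ⋁ℕ L' (λ n → fs n x)

module EndoOps {c ℓ} (L : CompleteLattice c ℓ) where
  open MapOps L L
  idM : Map L L
  idM x = x

  _^_ : Map L L → ℕ → Map L L
  f ^ zero = idM
  f ^ 1+ n = (f ^ n) ⨾ f

  _* : Map L L → Map L L
  f * = ⋁M (λ n → f ^ n)

-- S ⊆ FinAdd_L given as a predicate on maps.  Since set-membership is
-- extensional, we require the predicate to be closed under pointwise equality.
module _ {c ℓ s} (L : CompleteLattice c ℓ) (S : Map L L → Set s) where
 open MapOps L L
 open EndoOps L
 record StarContKA : Set (c ⊔ ℓ ⊔ s) where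
  field
    ext       : ∀ {f g} → f ≐ g → S f → S g
    finAdd    : ∀ {f} → S f → FinAdd L L f
    has-⊥     : S ⊥M
    has-id    : S idM
    closed-∨  : ∀ {f g} → S f → S g → S (f ∨M g)
    closed-⨾  : ∀ {f g} → S f → S g → S (f ⨾ g)
    closed-*  : ∀ {f} → S f → S (f *)
    ka-right-fix   : ∀ {x y} → S x → S y → (y ⨾ x *) ≐ ((y ⨾ x *) ⨾ x ∨M y)
    ka-right-least : ∀ {x y z} → S x → S y → S z → z ≐ (z ⨾ x ∨M y) → (y ⨾ x *) ⊑ z
    ka-left-fix    : ∀ {x y} → S x → S y → (x * ⨾ y) ≐ (x ⨾ (x * ⨾ y) ∨M y)
    ka-left-least  : ∀ {x y z} → S x → S y → S z → z ≐ (x ⨾ z ∨M y) → (x * ⨾ y) ⊑ z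
    cont-right : ∀ {x y} → S x → S y → (y ⨾ ⋁M (λ n → x ^ n)) ≐ ⋁M (λ n → y ⨾ (x ^ n))
    cont-left  : ∀ {x y} → S x → S y → (⋁M (λ n → x ^ n) ⨾ y) ≐ ⋁M (λ n → (x ^ n) ⨾ y)

module _ {c ℓ c' ℓ' s t} (L : CompleteLattice c ℓ) (L' : CompleteLattice c' ℓ')
         (S : Map L L → Set s) (V : Map L L' → Set t) where
 open MapOps L L'
 record Semimodule : Set (c ⊔ c' ⊔ s ⊔ t) where
  field
    ext       : ∀ {v w} → v ≐ w → V v → V w
    finAdd    : ∀ {v} → V v → FinAdd L L' v
    has-⊥     : V ⊥M
    closed-∨  : ∀ {v w} → V v → V w → V (v ∨M w)
    act       : ∀ {f v} → S f → V v → V (f ⨾ v)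

module _ {c ℓ c' ℓ' s t} (L : CompleteLattice c ℓ) (L' : CompleteLattice c' ℓ')
         (S : Map L L → Set s) (V : Map L L' → Set t) where
 open MapOps L L'
 open EndoOps L

 GenStarCont : Set (c ⊔ c' ⊔ s ⊔ t)
 GenStarCont =
  ∀ {x y v} → S x → S y → V v → (x ⨾ y * ⨾ v) ≐ ⋁M (λ n → x ⨾ (y ^ n) ⨾ v)

 StarActCont : Set (c ⊔ c' ⊔ s ⊔ t)
 StarActCont = ∀ {f v} → S f → V v → (f * ⨾ v) ≐ ⋁M (λ n → (f ^ n) ⨾ v)

module Submission where

-- Both directions rest on the fact that all operations on maps are pointwise.
--  (⇒) The generalized law  x y* v = ⋁ₙ x yⁿ v  specialised to x = id ∈ S is
--      exactly  y* v = ⋁ₙ yⁿ v,  since id is a left unit for composition.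
--  (⇐) Precomposing an equality of maps with x preserves it, and precomposition
--      commutes with pointwise joins:  x (⋁ₙ gₙ) = ⋁ₙ x gₙ.  So applying x on
--      the left of  y* v = ⋁ₙ yⁿ v  gives the generalized law.

open import Defs
open import Data.Nat using (ℕ)
open import Data.Product using (_×_; _,_)
open import Relation.Binary.PropositionalEquality using (refl; trans)

module Precomposition {c ℓ c' ℓ'} (L : CompleteLattice c ℓ) (L' : CompleteLattice c' ℓ') where
  open MapOps L L'

  ⨾-congˡ : (x : Map L L) {g h : Map L L'} → g ≐ h → (x ⨾ g) ≐ (x ⨾ h)
  ⨾-congˡ x g≐h a = g≐h (x a)

  ⨾-⋁M : (x : Map L L) (gs : ℕ → Map L L') → (x ⨾ ⋁M gs) ≐ ⋁M (λ n → x ⨾ gs n)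
  ⨾-⋁M x gs a = refl

module _ {c ℓ c' ℓ' s t} (L : CompleteLattice c ℓ) (L' : CompleteLattice c' ℓ')
         (S : Map L L → Set s) (V : Map L L' → Set t) where
  open EndoOps L
  open Precomposition L L'

  genStarCont⇒starActCont : S idM → GenStarCont L L' S V → StarActCont L L' S V
  genStarCont⇒starActCont S-id gen Sf Vv = gen S-id Sf Vv

  starActCont⇒genStarCont : StarActCont L L' S V → GenStarCont L L' S V
  starActCont⇒genStarCont act {x} {y} {v} Sx Sy Vv a =
    trans (⨾-congˡ x (act Sy Vv) a) (⨾-⋁M x (λ n → (y ^ n) ⨾ v) a)

mainTheorem11 : ∀ {c ℓ c' ℓ' s t} (L : CompleteLattice c ℓ) (L' : CompleteLattice c' ℓ')
    (S : Map L L → Set s) (V : Map L L' → Set t) →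
    StarContKA L S → Semimodule L L' S V →
    (GenStarCont L L' S V → StarActCont L L' S V)
    × (StarActCont L L' S V → GenStarCont L L' S V)
mainTheorem11 L L' S V ka _ =
  genStarCont⇒starActCont L L' S V (StarContKA.has-id ka) ,
  starActCont⇒genStarCont L L' S V
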